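{- Let $n,d_1,d_2$ be positive integers. If there exist a regular SMS$(n,d_1)$ and a regular SAMS$(n,d_2)$ which are compatible, then there exists a regular SAMS$(n,d_1+d_2)$.
   Context: For positive integers $n,d$ with $d<n$: an $n\times n$ array with entries in $\{0,1,\dots,nd\}$ in which each element of $\{1,\dots,nd\}$ occurs in exactly one entry (all other entries $0$) is a sparse magic square SMS$(n,d)$ if all row-sums, column-sums and the two main diagonal sums (entries $(i,i)$, resp. $(i,n+1-i)$) are equal; it is a sparse anti-magic square SAMS$(n,d)$ if these $2n+2$ sums form a set of $2n+2$ consecutive integers. Such a square is regular if every row, every column and both main diagonals contain exactly $d$ positive entries. For an $m\times n$ array $M=(m_{i,j})$ let $\Omega(M)=\{(i,j): m_{i,j}\neq 0\}$; two $m\times n$ arrays $M,N$ are compatible if $\Omega(M)\cap\Omega(N)=\emptyset$. -}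

module Defs where

open import Data.Nat using (ℕ; zero; suc; _+_; _*_; _≤_; _<_)
open import Data.Fin using (Fin; zero; suc; opposite)
open import Data.Product using (Σ; _×_; _,_; ∃)
open import Data.List using (List; _∷_; []; map; upTo; _++_; allFin)
open import Data.List.Relation.Binary.Permutation.Propositional using (_↭_)
open import Relation.Binary.PropositionalEquality using (_≡_; _≢_)
open import Relation.Nullary using (¬_)
open import Data.Empty using (⊥)
open import Data.List.Relation.Unary.All using (All)

Square : ℕ → Set
Square n = Fin n → Fin n → ℕ

sumFin : (n : ℕ) → (Fin n → ℕ) → ℕ
sumFin zero    f = 0
sumFin (suc n) f = f zero + sumFin n (λ i → f (suc i))

countPos : (n : ℕ) → (Fin n → ℕ) → ℕ
countPos zero    f = 0
countPos (suc n) f with f zero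
... | zero  = countPos n (λ i → f (suc i))
... | suc _ = suc (countPos n (λ i → f (suc i)))

module _ {n : ℕ} (M : Square n) where
  row col : Fin n → (Fin n → ℕ)
  row i = λ j → M i j
  col j = λ i → M i j

  -- entries (i,i) and (i, n+1-i) (opposite i = n-1-i in 0-based indexing)
  diag antidiag : Fin n → ℕ
  diag i = M i i
  antidiag i = M i (opposite i)

  lineSums : List ℕ
  lineSums = map (λ i → sumFin n (row i)) (allFin n)
          ++ map (λ j → sumFin n (col j)) (allFin n)
          ++ sumFin n diag ∷ sumFin n antidiag ∷ []

IsSparse : (n d : ℕ) → Square n → Set
IsSparse n d M =
  ((i j : Fin n) → M i j ≤ n * d) ×
  ((k : ℕ) → 1 ≤ k → k ≤ n * d →
     Σ (Fin n × Fin n) (λ { (i , j) → M i j ≡ k ×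
       ((i′ j′ : Fin n) → M i′ j′ ≡ k → (i′ ≡ i × j′ ≡ j)) }))

IsMagic : (n : ℕ) → Square n → Set
IsMagic n M = Σ ℕ λ s → All (λ t → t ≡ s) (lineSums M)

IsAntiMagic : (n : ℕ) → Square n → Set
IsAntiMagic n M = Σ ℕ λ a → lineSums M ↭ map (a +_) (upTo (2 * n + 2))

IsRegular : (n d : ℕ) → Square n → Set
IsRegular n d M =
  ((i : Fin n) → countPos n (row M i) ≡ d) ×
  ((j : Fin n) → countPos n (col M j) ≡ d) ×
  countPos n (diag M) ≡ d × countPos n (antidiag M) ≡ d

SMS : (n d : ℕ) → Square n → Set
SMS n d M = IsSparse n d M × IsMagic n M

SAMS : (n d : ℕ) → Square n → Set
SAMS n d M = IsSparse n d M × IsAntiMagic n M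

Compatible : {n : ℕ} → Square n → Square n → Set
Compatible {n} M N = (i j : Fin n) → M i j ≢ 0 → N i j ≢ 0 → ⊥

-- Put the nonzero entries of N, raised by c = n d₁, into the empty cells of M.  Since M is
-- magic with sum s and N has exactly d₂ positive entries on every line, each line sum of the
-- new square is s + d₂ c plus the corresponding line sum of N, so the line sums are those of N
-- translated by a constant.  The values 1, …, c come from M and c + 1, …, c + n d₂ from N,
-- and compatibility makes the counts of positive entries add up line by line.
module Submission where

open import Defs
open import Data.Nat using (ℕ; zero; suc; _+_; _*_; _∸_; _<_; _≤_; z<s; _≤?_)
open import Data.Nat.Properties
open import Algebra.Properties.CommutativeSemigroup +-commutativeSemigroup using (interchange)
open import Data.Fin using (Fin; zero; suc; opposite)
open import Data.Product using (Σ; _×_; _,_; proj₁; proj₂)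
open import Data.List using (List; _∷_; []; map; _++_; allFin)
open import Data.List.Properties using (map-∘; map-cong; map-cong-local; map-++)
open import Data.List.Relation.Unary.All as All using (All; _∷_; [])
import Data.List.Relation.Unary.All.Properties as All
open import Data.List.Relation.Binary.Permutation.Propositional using (↭-reflexive; ↭-trans)
import Data.List.Relation.Binary.Permutation.Propositional.Properties as ↭
open import Relation.Binary.PropositionalEquality
open import Relation.Nullary using (yes; no)
open import Data.Empty using (⊥; ⊥-elim)
open import Function using (_∘_)

open ≡-Reasoning

sumFin-cong : ∀ n {f g : Fin n → ℕ} → (∀ k → f k ≡ g k) → sumFin n f ≡ sumFin n g
sumFin-cong zero    f≗g = refl
sumFin-cong (suc n) f≗g = cong₂ _+_ (f≗g zero) (sumFin-cong n (f≗g ∘ suc))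

sumFin-+ : ∀ n (f g : Fin n → ℕ) → sumFin n (λ k → f k + g k) ≡ sumFin n f + sumFin n g
sumFin-+ zero    f g = refl
sumFin-+ (suc n) f g = begin
  (f zero + g zero) + sumFin n (λ k → f (suc k) + g (suc k))
    ≡⟨ cong (f zero + g zero +_) (sumFin-+ n (f ∘ suc) (g ∘ suc)) ⟩
  (f zero + g zero) + (sumFin n (f ∘ suc) + sumFin n (g ∘ suc))
    ≡⟨ interchange (f zero) (g zero) _ _ ⟩
  sumFin (suc n) f + sumFin (suc n) g ∎

sumFin-*ʳ : ∀ n (f : Fin n → ℕ) c → sumFin n (λ k → f k * c) ≡ sumFin n f * c
sumFin-*ʳ zero    f c = refl
sumFin-*ʳ (suc n) f c = begin
  f zero * c + sumFin n (λ k → f (suc k) * c) ≡⟨ cong (f zero * c +_) (sumFin-*ʳ n (f ∘ suc) c) ⟩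
  f zero * c + sumFin n (f ∘ suc) * c         ≡⟨ *-distribʳ-+ c (f zero) _ ⟨
  sumFin (suc n) f * c                        ∎

signum : ℕ → ℕ
signum zero    = 0
signum (suc _) = 1

countPos≡sumFin-signum : ∀ n (f : Fin n → ℕ) → countPos n f ≡ sumFin n (signum ∘ f)
countPos≡sumFin-signum zero    f = refl
countPos≡sumFin-signum (suc n) f with f zero
... | zero  = countPos≡sumFin-signum n (f ∘ suc)
... | suc _ = cong suc (countPos≡sumFin-signum n (f ∘ suc))

signum-+ : ∀ a b → (a ≢ 0 → b ≢ 0 → ⊥) → signum (a + b) ≡ signum a + signum b
signum-+ zero    b       _        = refl
signum-+ (suc a) zero    _        = refl
signum-+ (suc a) (suc b) disjoint = ⊥-elim (disjoint (λ ()) (λ ()))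

countPos-+ : ∀ n (f g : Fin n → ℕ) → (∀ k → f k ≢ 0 → g k ≢ 0 → ⊥) →
  countPos n (λ k → f k + g k) ≡ countPos n f + countPos n g
countPos-+ n f g disjoint = begin
  countPos n (λ k → f k + g k)                     ≡⟨ countPos≡sumFin-signum n _ ⟩
  sumFin n (λ k → signum (f k + g k))              ≡⟨ sumFin-cong n (λ k → signum-+ (f k) (g k) (disjoint k)) ⟩
  sumFin n (λ k → signum (f k) + signum (g k))     ≡⟨ sumFin-+ n _ _ ⟩
  sumFin n (signum ∘ f) + sumFin n (signum ∘ g)    ≡⟨ cong₂ _+_ (countPos≡sumFin-signum n f)
                                                               (countPos≡sumFin-signum n g) ⟨
  countPos n f + countPos n g                      ∎

shiftPos : ℕ → ℕ → ℕ
shiftPos c zero    = 0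
shiftPos c (suc b) = c + suc b

shiftPos-pos : ∀ c {b} → 0 < b → shiftPos c b ≡ c + b
shiftPos-pos c {suc b} _ = refl

shiftPos≢0⇒≢0 : ∀ c b → shiftPos c b ≢ 0 → b ≢ 0
shiftPos≢0⇒≢0 c zero    shifted≢0 = shifted≢0
shiftPos≢0⇒≢0 c (suc b) _         = λ ()

signum-shiftPos : ∀ c b → signum (shiftPos c b) ≡ signum b
signum-shiftPos c zero    = refl
signum-shiftPos c (suc b) rewrite +-suc c b = refl

shiftPos≡signum*+ : ∀ c b → shiftPos c b ≡ signum b * c + b
shiftPos≡signum*+ c zero    = refl
shiftPos≡signum*+ c (suc b) = cong (_+ suc b) (sym (+-identityʳ c))

countPos-shiftPos : ∀ n c (g : Fin n → ℕ) → countPos n (shiftPos c ∘ g) ≡ countPos n g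
countPos-shiftPos n c g = begin
  countPos n (shiftPos c ∘ g)              ≡⟨ countPos≡sumFin-signum n _ ⟩
  sumFin n (signum ∘ shiftPos c ∘ g)       ≡⟨ sumFin-cong n (signum-shiftPos c ∘ g) ⟩
  sumFin n (signum ∘ g)                    ≡⟨ countPos≡sumFin-signum n g ⟨
  countPos n g                             ∎

sumFin-shiftPos : ∀ n c (g : Fin n → ℕ) →
  sumFin n (shiftPos c ∘ g) ≡ countPos n g * c + sumFin n g
sumFin-shiftPos n c g = begin
  sumFin n (shiftPos c ∘ g)                   ≡⟨ sumFin-cong n (shiftPos≡signum*+ c ∘ g) ⟩
  sumFin n (λ k → signum (g k) * c + g k)     ≡⟨ sumFin-+ n _ g ⟩
  sumFin n (λ k → signum (g k) * c) + sumFin n g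
    ≡⟨ cong (_+ sumFin n g) (sumFin-*ʳ n (signum ∘ g) c) ⟩
  sumFin n (signum ∘ g) * c + sumFin n g      ≡⟨ cong (λ t → t * c + sumFin n g) (countPos≡sumFin-signum n g) ⟨
  countPos n g * c + sumFin n g               ∎

overlay : ℕ → ℕ → ℕ → ℕ
overlay c a b = a + shiftPos c b

sumFin-overlay : ∀ n c (f g : Fin n → ℕ) →
  sumFin n (λ k → overlay c (f k) (g k)) ≡ sumFin n f + (countPos n g * c + sumFin n g)
sumFin-overlay n c f g =
  trans (sumFin-+ n f (shiftPos c ∘ g)) (cong (sumFin n f +_) (sumFin-shiftPos n c g))

countPos-overlay : ∀ n c (f g : Fin n → ℕ) → (∀ k → f k ≢ 0 → g k ≢ 0 → ⊥) →
  countPos n (λ k → overlay c (f k) (g k)) ≡ countPos n f + countPos n g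
countPos-overlay n c f g disjoint = begin
  countPos n (λ k → overlay c (f k) (g k))
    ≡⟨ countPos-+ n f (shiftPos c ∘ g) (λ k f≢0 → disjoint k f≢0 ∘ shiftPos≢0⇒≢0 c (g k)) ⟩
  countPos n f + countPos n (shiftPos c ∘ g) ≡⟨ cong (countPos n f +_) (countPos-shiftPos n c g) ⟩
  countPos n f + countPos n g                ∎

overlay-≤ : ∀ {c e a} b → a ≤ c → b ≤ e → (b ≢ 0 → a ≡ 0) → overlay c a b ≤ c + e
overlay-≤ {c} {e} {a} zero    a≤c _   _        = ≤-trans (≤-reflexive (+-identityʳ a)) (m≤n⇒m≤n+o e a≤c)
overlay-≤ {c}         (suc b) _   b≤e b≢0⇒a≡0 rewrite b≢0⇒a≡0 (λ ()) = +-monoʳ-≤ c b≤e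

overlay≡low⇒ : ∀ {c k} a b → k ≤ c → overlay c a b ≡ k → a ≡ k
overlay≡low⇒     a zero    _   a+0≡k = trans (sym (+-identityʳ a)) a+0≡k
overlay≡low⇒ {c} a (suc b) k≤c a+[c+1+b]≡k = ⊥-elim (<⇒≱ c<k k≤c)
  where
  c<k : c < _
  c<k = <-≤-trans (m<m+n c z<s) (≤-trans (m≤n+m _ a) (≤-reflexive a+[c+1+b]≡k))

overlay≡high⇒ : ∀ {c k} a b → 0 < k → a ≤ c → (b ≢ 0 → a ≡ 0) → overlay c a b ≡ c + k → b ≡ k
overlay≡high⇒ {c} {k} a zero 0<k a≤c _ a+0≡c+k = ⊥-elim (<⇒≢ a+0<c+k a+0≡c+k)
  where
  a+0<c+k : a + 0 < c + k
  a+0<c+k = ≤-<-trans (≤-trans (≤-reflexive (+-identityʳ a)) a≤c) (m<m+n c 0<k)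
overlay≡high⇒ {c} a (suc b) _ _ b≢0⇒a≡0 a+[c+1+b]≡c+k =
  +-cancelˡ-≡ c _ _ (trans (cong (_+ (c + suc b)) (sym (b≢0⇒a≡0 (λ ())))) a+[c+1+b]≡c+k)

overlaySquare : ∀ {n} → ℕ → Square n → Square n → Square n
overlaySquare c M N i j = overlay c (M i j) (N i j)

IsCellOf : ∀ {n} → Square n → ℕ → Fin n × Fin n → Set
IsCellOf {n} M k (i , j) = M i j ≡ k × ((i′ j′ : Fin n) → M i′ j′ ≡ k → i′ ≡ i × j′ ≡ j)

UniqueCell : ∀ {n} → Square n → ℕ → Set
UniqueCell {n} M k = Σ (Fin n × Fin n) (IsCellOf M k)

≢0-disjoint⇒≡0 : ∀ a {b} → (a ≢ 0 → b ≢ 0 → ⊥) → b ≢ 0 → a ≡ 0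
≢0-disjoint⇒≡0 zero    _        _   = refl
≢0-disjoint⇒≡0 (suc a) disjoint b≢0 = ⊥-elim (disjoint (λ ()) b≢0)

sparse-overlay : ∀ {n d₁ d₂} {M N : Square n} →
  IsSparse n d₁ M → IsSparse n d₂ N → Compatible M N →
  IsSparse n (d₁ + d₂) (overlaySquare (n * d₁) M N)
sparse-overlay {n} {d₁} {d₂} {M} {N} (boundM , cellM) (boundN , cellN) compat = bound , cell
  where
  c = n * d₁
  P = overlaySquare c M N

  M≡0 : ∀ i j → N i j ≢ 0 → M i j ≡ 0
  M≡0 i j = ≢0-disjoint⇒≡0 (M i j) (compat i j)

  N≡0 : ∀ i j → M i j ≢ 0 → N i j ≡ 0
  N≡0 i j = ≢0-disjoint⇒≡0 (N i j) (λ N≢0 M≢0 → compat i j M≢0 N≢0)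

  bound : ∀ i j → P i j ≤ n * (d₁ + d₂)
  bound i j = ≤-trans (overlay-≤ (N i j) (boundM i j) (boundN i j) (M≡0 i j))
                      (≤-reflexive (sym (*-distribˡ-+ n d₁ d₂)))

  lowCell : ∀ k → 0 < k → k ≤ c → UniqueCell P k
  lowCell k 0<k k≤c with cellM k 0<k k≤c
  ... | (i , j) , Mij≡k , unique = (i , j) , Pij≡k , λ i′ j′ → unique i′ j′ ∘ overlay≡low⇒ (M i′ j′) (N i′ j′) k≤c
    where
    Pij≡k : overlay c (M i j) (N i j) ≡ k
    Pij≡k = begin
      overlay c (M i j) (N i j) ≡⟨ cong (overlay c (M i j)) (N≡0 i j (n>0⇒n≢0 (subst (0 <_) (sym Mij≡k) 0<k))) ⟩
      M i j + 0                 ≡⟨ +-identityʳ (M i j) ⟩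
      M i j                     ≡⟨ Mij≡k ⟩
      k                         ∎

  highCell : ∀ k → 0 < k → k ≤ n * d₂ → UniqueCell P (c + k)
  highCell k 0<k k≤nd₂ with cellN k 0<k k≤nd₂
  ... | (i , j) , Nij≡k , unique =
    (i , j) , Pij≡c+k , λ i′ j′ → unique i′ j′ ∘ overlay≡high⇒ (M i′ j′) (N i′ j′) 0<k (boundM i′ j′) (M≡0 i′ j′)
    where
    Pij≡c+k : overlay c (M i j) (N i j) ≡ c + k
    Pij≡c+k = begin
      overlay c (M i j) (N i j) ≡⟨ cong₂ (overlay c) (M≡0 i j (n>0⇒n≢0 (subst (0 <_) (sym Nij≡k) 0<k))) Nij≡k ⟩
      shiftPos c k              ≡⟨ shiftPos-pos c 0<k ⟩
      c + k                     ∎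

  cell : ∀ k → 1 ≤ k → k ≤ n * (d₁ + d₂) → UniqueCell P k
  cell k 0<k k≤n[d₁+d₂] with k ≤? c
  ... | yes k≤c = lowCell k 0<k k≤c
  ... | no  k≰c = subst (UniqueCell P) (m+[n∸m]≡n (<⇒≤ c<k))
                    (highCell (k ∸ c) (m<n⇒0<n∸m c<k)
                       (m≤n+o⇒m∸n≤o k c (≤-trans k≤n[d₁+d₂] (≤-reflexive (*-distribˡ-+ n d₁ d₂)))))
    where
    c<k : c < k
    c<k = ≰⇒> k≰c

Line : ℕ → Set
Line n = Fin n → Fin n × Fin n

along : ∀ {n} → Square n → Line n → Fin n → ℕ
along M ℓ k = M (proj₁ (ℓ k)) (proj₂ (ℓ k))

lines : (n : ℕ) → List (Line n)
lines n = map (λ i j → i , j) (allFin n) ++ map (λ j i → i , j) (allFin n)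
       ++ (λ i → i , i) ∷ (λ i → i , opposite i) ∷ []

lineSums≡map-lines : ∀ {n} (M : Square n) → lineSums M ≡ map (sumFin n ∘ along M) (lines n)
lineSums≡map-lines {n} M = sym (begin
  map sumAlong (rows ++ cols ++ diags)                    ≡⟨ map-++ sumAlong rows (cols ++ diags) ⟩
  map sumAlong rows ++ map sumAlong (cols ++ diags)       ≡⟨ cong (map sumAlong rows ++_) (map-++ sumAlong cols diags) ⟩
  map sumAlong rows ++ map sumAlong cols ++ map sumAlong diags
    ≡⟨ cong₂ _++_ (map-∘ (allFin n)) (cong (_++ map sumAlong diags) (map-∘ (allFin n))) ⟨
  lineSums M                                              ∎)
  where
  sumAlong = sumFin n ∘ along M
  rows  = map (λ i j → i , j) (allFin n)
  cols  = map (λ j i → i , j) (allFin n)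
  diags = (λ i → i , i) ∷ (λ i → i , opposite i) ∷ []

magic-lines : ∀ {n s} (M : Square n) → All (_≡ s) (lineSums M) →
  All (λ ℓ → sumFin n (along M ℓ) ≡ s) (lines n)
magic-lines {s = s} M all≡s = All.map⁻ (subst (All (_≡ s)) (lineSums≡map-lines M) all≡s)

regular-lines : ∀ {n d} (M : Square n) → IsRegular n d M →
  All (λ ℓ → countPos n (along M ℓ) ≡ d) (lines n)
regular-lines M (rows , cols , diag , antidiag) =
  All.++⁺ (All.map⁺ (All.tabulate⁺ rows)) (All.++⁺ (All.map⁺ (All.tabulate⁺ cols)) (diag ∷ antidiag ∷ []))

lineSums-overlay : ∀ {n d s} c (M N : Square n) →
  All (λ ℓ → sumFin n (along M ℓ) ≡ s) (lines n) →
  All (λ ℓ → countPos n (along N ℓ) ≡ d) (lines n) →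
  lineSums (overlaySquare c M N) ≡ map ((s + d * c) +_) (lineSums N)
lineSums-overlay {n} {d} {s} c M N sumsM countsN = begin
  lineSums P                                                ≡⟨ lineSums≡map-lines P ⟩
  map (sumFin n ∘ along P) (lines n)                        ≡⟨ map-cong-local (All.zipWith lineSum (sumsM , countsN)) ⟩
  map (((s + d * c) +_) ∘ sumFin n ∘ along N) (lines n)     ≡⟨ map-∘ (lines n) ⟩
  map ((s + d * c) +_) (map (sumFin n ∘ along N) (lines n)) ≡⟨ cong (map _) (lineSums≡map-lines N) ⟨
  map ((s + d * c) +_) (lineSums N)                         ∎
  where
  P = overlaySquare c M N

  lineSum : ∀ {ℓ} → sumFin n (along M ℓ) ≡ s × countPos n (along N ℓ) ≡ d →
    sumFin n (along P ℓ) ≡ s + d * c + sumFin n (along N ℓ)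
  lineSum {ℓ} (sumM≡s , countN≡d) = begin
    sumFin n (along P ℓ)
      ≡⟨ sumFin-overlay n c (along M ℓ) (along N ℓ) ⟩
    sumFin n (along M ℓ) + (countPos n (along N ℓ) * c + sumFin n (along N ℓ))
      ≡⟨ cong₂ (λ x y → x + (y * c + sumFin n (along N ℓ))) sumM≡s countN≡d ⟩
    s + (d * c + sumFin n (along N ℓ))
      ≡⟨ +-assoc s (d * c) _ ⟨
    s + d * c + sumFin n (along N ℓ) ∎

antiMagic-overlay : ∀ {n d} c (M N : Square n) →
  IsMagic n M → IsAntiMagic n N → IsRegular n d N → IsAntiMagic n (overlaySquare c M N)
antiMagic-overlay {n} {d} c M N (s , all≡s) (a , lineSumsN↭) regN =
  s + d * c + a ,
  ↭-trans (↭-reflexive (lineSums-overlay c M N (magic-lines M all≡s) (regular-lines N regN)))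
    (↭-trans (↭.map⁺ ((s + d * c) +_) lineSumsN↭) (↭-reflexive (map-+-+ (s + d * c) a _)))
  where
  map-+-+ : ∀ x y (zs : List ℕ) → map (x +_) (map (y +_) zs) ≡ map ((x + y) +_) zs
  map-+-+ x y zs = trans (sym (map-∘ zs)) (map-cong (λ z → sym (+-assoc x y z)) zs)

regular-overlay : ∀ {n d₁ d₂} c (M N : Square n) → Compatible M N →
  IsRegular n d₁ M → IsRegular n d₂ N → IsRegular n (d₁ + d₂) (overlaySquare c M N)
regular-overlay {n} c M N compat (rowsM , colsM , diagM , antidiagM) (rowsN , colsN , diagN , antidiagN) =
    (λ i → countPos-along (λ j → i , j) (rowsM i) (rowsN i))
  , (λ j → countPos-along (λ i → i , j) (colsM j) (colsN j))
  , countPos-along (λ i → i , i) diagM diagN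
  , countPos-along (λ i → i , opposite i) antidiagM antidiagN
  where
  countPos-along : ∀ {p q} ℓ → countPos n (along M ℓ) ≡ p → countPos n (along N ℓ) ≡ q →
    countPos n (along (overlaySquare c M N) ℓ) ≡ p + q
  countPos-along ℓ refl refl = countPos-overlay n c (along M ℓ) (along N ℓ) (λ k → compat _ _)

theorem4p4 : (n d₁ d₂ : ℕ) → 0 < n → 0 < d₁ → 0 < d₂ → d₁ < n → d₂ < n →
    (M N : Square n) →
    SMS n d₁ M → IsRegular n d₁ M →
    SAMS n d₂ N → IsRegular n d₂ N →
    Compatible M N →
    Σ (Square n) (λ P → SAMS n (d₁ + d₂) P × IsRegular n (d₁ + d₂) P)
theorem4p4 n d₁ d₂ _ _ _ _ _ M N (sparseM , magicM) regM (sparseN , antiMagicN) regN compat =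
  overlaySquare (n * d₁) M N ,
  (sparse-overlay sparseM sparseN compat , antiMagic-overlay (n * d₁) M N magicM antiMagicN regN) ,
  regular-overlay (n * d₁) M N compat regM regN
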